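{- Let $((A_i,B_i))_{i\in\mathbb N}$ be a strictly increasing sequence of oriented separations of a graph $G$, and let $(P_i)_{i\in\mathbb N}$ be a sequence of pre-tangles in $G$ such that (IM1) $(B_i,A_i)\in P_i$ and $(A_i,B_i)\in P_{i+1}$ for all $i\in\mathbb N$; and (IM2') $\{A_i,B_i\}$ efficiently distinguishes $P_i$ and $P_{i+1}$ for all $i\in\mathbb N$. Then for all $i<j$ in $\mathbb N$, every separation of minimal order among $\{A_i,B_i\},\dots,\{A_{j-1},B_{j-1}\}$ efficiently distinguishes $P_i$ and $P_j$.
   Context: A separation of a graph $G$ is an unordered pair $\{A,B\}$ of subsets of $V(G)$ with $A\cup B=V(G)$ and no edge between $A\setminus B$ and $B\setminus A$; its order is $|A\cap B|$. Oriented separations are ordered by $(A,B)\le(C,D)$ iff $A\subseteq C$ and $B\supseteq D$. A set $O$ of oriented separations is consistent if there are no $(A,B),(C,D)\in O$ with $\{A,B\}\ne\{C,D\}$ and $(B,A)\le(C,D)$. A pre-tangle in $G$ is a set $P$ which, for some $k\in\mathbb N\cup\{\aleph_0\}$, is a consistent set containing exactly one orientation of each separation of $G$ of order less than $k$. A separation distinguishes two pre-tangles if both contain one of its orientations but not the same one, and does so efficiently if it has minimum order among all separations of $G$ distinguishing them. -}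

module Defs where

open import Level using (Level; 0ℓ) renaming (suc to lsuc)
open import Data.Nat using (ℕ; _≤_; _<_)
open import Data.List using (List; length)
open import Data.List.Relation.Unary.Unique.Propositional using (Unique)
open import Data.List.Membership.Propositional using (_∈_)
open import Data.Product using (Σ; _×_; _,_; proj₁; proj₂)
open import Data.Sum using (_⊎_)
open import Data.Empty using (⊥)
open import Relation.Nullary using (¬_)
open import Relation.Binary.PropositionalEquality using (_≡_)
open import Function.Bundles using (_⇔_)

record Graph : Set₁ where
  field
    V    : Set
    E    : V → V → Set
    sym  : ∀ {u v} → E u v → E v u
    irr  : ∀ {v} → ¬ E v v

module _ (G : Graph) where
  open Graph G

  VSet : Set₁
  VSet = V → Set

  _⊆_ : VSet → VSet → Set
  X ⊆ Y = ∀ v → X v → Y v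

  _≐_ : VSet → VSet → Set
  X ≐ Y = (X ⊆ Y) × (Y ⊆ X)

  OSep : Set₁
  OSep = VSet × VSet

  IsSep : VSet → VSet → Set
  IsSep A B = (∀ v → A v ⊎ B v)
            × (∀ u v → A u → ¬ B u → B v → ¬ A v → ¬ E u v)

  -- |A ∩ B| = n  (A ∩ B is finite with exactly n elements)
  OrderIs : VSet → VSet → ℕ → Set
  OrderIs A B n = Σ (List V) λ xs →
    Unique xs × (length xs ≡ n) × (∀ v → ((A v × B v) ⇔ (v ∈ xs)))

  data Bound : Set where
    fin : ℕ → Bound
    ℵ₀  : Bound

  OrderLt : VSet → VSet → Bound → Set
  OrderLt A B (fin k) = Σ ℕ λ n → OrderIs A B n × (n < k)
  OrderLt A B ℵ₀      = Σ ℕ λ n → OrderIs A B n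

  _≤ₛ_ : OSep → OSep → Set
  (A , B) ≤ₛ (C , D) = (A ⊆ C) × (D ⊆ B)

  _≡ₛ_ : OSep → OSep → Set
  (A , B) ≡ₛ (C , D) = (A ≐ C) × (B ≐ D)

  _<ₛ_ : OSep → OSep → Set
  s <ₛ t = (s ≤ₛ t) × ¬ (s ≡ₛ t)

  SameSep : OSep → OSep → Set
  SameSep (A , B) (C , D) = ((A , B) ≡ₛ (C , D)) ⊎ ((A , B) ≡ₛ (D , C))

  SepSet : Set₁
  SepSet = OSep → Set

  Consistent : SepSet → Set₁
  Consistent O = ∀ A B C D → O (A , B) → O (C , D) →
    ¬ SameSep (A , B) (C , D) → ¬ ((B , A) ≤ₛ (C , D))

  IsPreTangleOfOrder : SepSet → Bound → Set₁
  IsPreTangleOfOrder P k =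
      -- P is a set of oriented separations (well defined up to ≐)
      (∀ s t → s ≡ₛ t → P s → P t)
    × Consistent P
    × (∀ A B → P (A , B) → IsSep A B × OrderLt A B k)
    × (∀ A B → IsSep A B → OrderLt A B k →
         (P (A , B) ⊎ P (B , A))
         × (P (A , B) → P (B , A) → (A , B) ≡ₛ (B , A)))

  IsPreTangle : SepSet → Set₁
  IsPreTangle P = Σ Bound λ k → IsPreTangleOfOrder P k

  Distinguishes : SepSet → SepSet → VSet → VSet → Set
  Distinguishes P Q A B =
      (P (A , B) ⊎ P (B , A))
    × (Q (A , B) ⊎ Q (B , A))
    × ¬ (P (A , B) × Q (A , B))
    × ¬ (P (B , A) × Q (B , A))

  EffDistinguishes : SepSet → SepSet → VSet → VSet → Set₁
  EffDistinguishes P Q A B =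
      IsSep A B
    × Distinguishes P Q A B
    × (∀ (C D : VSet) → IsSep C D → Distinguishes P Q C D →
         ∀ n m → OrderIs A B n → OrderIs C D m → n ≤ m)

{-# OPTIONS --safe #-}
-- Consistency forces the orientations of {A l, B l} along the chain: for i ≤ m < l the
-- pre-tangle P m contains (B m, A m) with (A m, B m) ≤ (A l, B l), so it cannot contain
-- (A l, B l); dually P m contains (A l, B l) for l < m ≤ j. Minimality of the order of
-- {A l, B l} ensures that each of these P m orients it at all. Hence {A l, B l}
-- distinguishes P i and P j. Conversely, a separation distinguishing P i and P j must leave
-- the orientation it has in P i somewhere between i and j: either P (m+1) holds the other
-- orientation, and (IM2') bounds its order below by that of {A m, B m}, or P (m+1) does not
-- orient it, and its order is at least that of {A (m+1), B (m+1)}. Separations with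
-- A m = V(G) are ruled out by an infinite descent of orders.
module Submission where

open import Defs hiding (_⊆_)
open import Level using (0ℓ)
open import Data.Nat using (ℕ; suc; _≤_; _<_; _≤′_; ≤′-refl; ≤′-step; z≤n; s≤s; _<?_)
open import Data.Nat.Properties
  using ( module ≤-Reasoning; ≤-refl; ≤-trans; ≤-antisym; ≤-<-trans; <⇒≤; ≰⇒>; _≤?_; n≤1+n
        ; ≤⇒≤′; m≤n⇒m<n∨m≡n)
open import Data.Nat.Induction using (<-wellFounded)
open import Data.List using (List; []; _∷_; length)
open import Data.List.Properties using (length-removeAt′)
open import Data.List.Relation.Unary.Any using (here; there; index; _─_)
open import Data.List.Relation.Unary.All as All using ()
open import Data.List.Relation.Unary.AllPairs using (_∷_)
open import Data.List.Relation.Unary.Unique.Propositional using (Unique)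
open import Data.List.Membership.Propositional using (_∈_; _∉_)
open import Data.List.Relation.Binary.Subset.Propositional using (_⊆_)
open import Data.Product using (∃; _×_; _,_; proj₁; proj₂; swap)
open import Data.Sum using (_⊎_; inj₁; inj₂; [_,_]′) renaming (swap to ⊎-swap)
open import Function using (_∘_; id)
open import Function.Bundles using (Equivalence; mk⇔)
open import Induction.InfiniteDescent using (descent∧wf⇒empty)
open import Relation.Binary.PropositionalEquality using (_≡_; _≢_; refl; sym; ≢-sym; subst)
open import Relation.Nullary using (¬_; Dec; yes; no; contradiction)
open import Relation.Nullary.Negation using (¬¬-Monad)

module _ {A : Set} where

  ∈-─⁺ : ∀ {x v} {ys : List A} (p : x ∈ ys) → v ∈ ys → v ≢ x → v ∈ (ys ─ p)
  ∈-─⁺ (here refl) (here refl) v≢x = contradiction refl v≢x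
  ∈-─⁺ (here refl) (there v∈ys) _  = v∈ys
  ∈-─⁺ (there p)   (here refl)  _  = here refl
  ∈-─⁺ (there p)   (there v∈ys) v≢x = there (∈-─⁺ p v∈ys v≢x)

  length-─ : ∀ {x} (ys : List A) (p : x ∈ ys) → length ys ≡ suc (length (ys ─ p))
  length-─ ys p = length-removeAt′ ys (index p)

  unique-⊆⇒length-≤ : ∀ {xs ys : List A} → Unique xs → xs ⊆ ys → length xs ≤ length ys
  unique-⊆⇒length-≤ {[]}     _               _     = z≤n
  unique-⊆⇒length-≤ {x ∷ xs} {ys} (x∉xs ∷ u) xs⊆ys = begin
    suc (length xs)        ≤⟨ s≤s (unique-⊆⇒length-≤ u xs⊆ys─p) ⟩
    suc (length (ys ─ p))  ≡⟨ sym (length-─ ys p) ⟩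
    length ys              ∎
    where
    open ≤-Reasoning
    p = xs⊆ys (here refl)
    xs⊆ys─p : xs ⊆ (ys ─ p)
    xs⊆ys─p v∈xs = ∈-─⁺ p (xs⊆ys (there v∈xs)) (≢-sym (All.lookup x∉xs v∈xs))

  unique-⊂⇒length-< : ∀ {x} {xs ys : List A} → Unique xs → xs ⊆ ys → x ∈ ys → x ∉ xs →
                      length xs < length ys
  unique-⊂⇒length-< {xs = xs} {ys} u xs⊆ys p x∉xs = begin-strict
    length xs              <⟨ s≤s (unique-⊆⇒length-≤ u xs⊆ys─p) ⟩
    suc (length (ys ─ p))  ≡⟨ sym (length-─ ys p) ⟩
    length ys              ∎
    where
    open ≤-Reasoning
    xs⊆ys─p : xs ⊆ (ys ─ p)
    xs⊆ys─p v∈xs = ∈-─⁺ p (xs⊆ys v∈xs) λ { refl → x∉xs v∈xs }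

  -- Membership is not decidable here, so a missing element of ys is only found under ¬¬.
  unique-⊆-⊉⇒length-< : ∀ {xs ys : List A} → Unique xs → xs ⊆ ys → ¬ ys ⊆ xs →
                        length xs < length ys
  unique-⊆-⊉⇒length-< {xs} {ys} u xs⊆ys ys⊈xs with length xs <? length ys
  ... | yes xs<ys = xs<ys
  ... | no  xs≮ys = contradiction (λ all → ys⊈xs (All.lookup all)) ¬¬ys⊆xs
    where
    ¬¬ys⊆xs : ¬ ¬ All.All (_∈ xs) ys
    ¬¬ys⊆xs = All.sequenceM 0ℓ ¬¬-Monad
      (All.tabulate λ x∈ys x∉xs → xs≮ys (unique-⊂⇒length-< u xs⊆ys x∈ys x∉xs))

-- A constructive crossing argument: Q cannot be decided, so each step must either
-- propagate Q or produce R outright.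
module _ {Q : ℕ → Set} {R : Set} {i j : ℕ}
         (step : ∀ m → i ≤ m → m < j → Q m → Q (suc m) ⊎ R) (Qi : Q i) where

  private
    reach : ∀ m → i ≤ m → m ≤ j → Q m ⊎ R
    reach m i≤m m≤j with m≤n⇒m<n∨m≡n i≤m
    ... | inj₂ refl = inj₁ Qi
    reach (suc m) _ m<j | inj₁ (s≤s i≤m) =
      [ step m i≤m m<j , inj₂ ]′ (reach m i≤m (≤-trans (n≤1+n m) m<j))

  crossing : ¬ Q j → i ≤ j → R
  crossing ¬Qj i≤j = [ (λ Qj → contradiction Qj ¬Qj) , id ]′ (reach j i≤j ≤-refl)

module Separations (G : Graph) where
  open Equivalence

  private
    variable
      X Y C D E F : VSet G
      P Q : SepSet G
      m n : ℕ
      k : Bound G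

  order-≤ : OrderIs G X Y m → OrderIs G X Y n → m ≤ n
  order-≤ (xs , u , refl , xs↔) (ys , _ , refl , ys↔) =
    unique-⊆⇒length-≤ u λ {v} v∈xs → to (ys↔ v) (from (xs↔ v) v∈xs)

  order-unique : OrderIs G X Y m → OrderIs G X Y n → m ≡ n
  order-unique o o′ = ≤-antisym (order-≤ o o′) (order-≤ o′ o)

  orderIs-swap : OrderIs G X Y n → OrderIs G Y X n
  orderIs-swap (xs , u , len , xs↔) = xs , u , len , λ v →
    mk⇔ (λ yx → to (xs↔ v) (swap yx)) (λ v∈xs → swap (from (xs↔ v) v∈xs))

  orderLt-swap : OrderLt G X Y k → OrderLt G Y X k
  orderLt-swap {k = fin _} (n , o , n<k) = n , orderIs-swap o , n<k
  orderLt-swap {k = ℵ₀}    (n , o)       = n , orderIs-swap o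

  orderLt⇒orderIs : OrderLt G X Y k → ∃ (OrderIs G X Y)
  orderLt⇒orderIs {k = fin _} (n , o , _) = n , o
  orderLt⇒orderIs {k = ℵ₀}    (n , o)     = n , o

  orderLt-≤ : OrderLt G X Y k → OrderIs G X Y n → OrderIs G E F m → m ≤ n → OrderLt G E F k
  orderLt-≤ {k = fin k} (n′ , o′ , n′<k) o oEF m≤n =
    _ , oEF , ≤-<-trans m≤n (subst (_< k) (order-unique o′ o) n′<k)
  orderLt-≤ {k = ℵ₀}    _                _ oEF _   = _ , oEF

  orderLt? : OrderIs G X Y n → (k : Bound G) → Dec (OrderLt G X Y k)
  orderLt? {n = n} o (fin k) with n <? k
  ... | yes n<k = yes (n , o , n<k)
  ... | no  n≮k = no λ (n′ , o′ , n′<k) → n≮k (subst (_< k) (order-unique o′ o) n′<k)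
  orderLt? {n = n} o ℵ₀ = yes (n , o)

  ¬orderLt⇒≥ : OrderLt G X Y k → ¬ OrderLt G E F k → OrderIs G X Y n → OrderIs G E F m → n ≤ m
  ¬orderLt⇒≥ {n = n} {m = m} lt ¬lt o oEF with n ≤? m
  ... | yes n≤m = n≤m
  ... | no  n≰m = contradiction (orderLt-≤ lt o oEF (<⇒≤ (≰⇒> n≰m))) ¬lt

  -- Vacuous when either order is infinite.
  OrderLe : OSep G → OSep G → Set
  OrderLe (X , Y) (E , F) = ∀ n m → OrderIs G X Y n → OrderIs G E F m → n ≤ m

  isSep-swap : IsSep G X Y → IsSep G Y X
  isSep-swap (cover , noEdge) =
    (⊎-swap ∘ cover) , λ u v Yu ¬Xu Xv ¬Yv → noEdge v u Xv ¬Yv Yu ¬Xu ∘ Graph.sym G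

  isSep-total : IsSep G X Y → (∀ v → Y v → X v) → ∀ v → X v
  isSep-total (cover , _) Y⊆X v = [ id , Y⊆X v ]′ (cover v)

  ≤ₛ-trans : _≤ₛ_ G (X , Y) (C , D) → _≤ₛ_ G (C , D) (E , F) → _≤ₛ_ G (X , Y) (E , F)
  ≤ₛ-trans (A⊆C , D⊆B) (C⊆E , F⊆D) = (λ v → C⊆E v ∘ A⊆C v) , (λ v → D⊆B v ∘ F⊆D v)

  sameSep-flipˡ : SameSep G (X , Y) (E , F) → SameSep G (Y , X) (E , F)
  sameSep-flipˡ = ⊎-swap ∘ [ inj₁ ∘ swap , inj₂ ∘ swap ]′

  sameSep-sym : SameSep G (X , Y) (E , F) → SameSep G (E , F) (X , Y)
  sameSep-sym (inj₁ (X≐E , Y≐F)) = inj₁ (swap X≐E , swap Y≐F)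
  sameSep-sym (inj₂ (X≐F , Y≐E)) = inj₂ (swap Y≐E , swap X≐F)

  Distinguishes-swap : Distinguishes G P Q X Y → Distinguishes G P Q Y X
  Distinguishes-swap (p , q , ¬XY , ¬YX) = ⊎-swap p , ⊎-swap q , ¬YX , ¬XY

  module PreTangle (pt : IsPreTangle G P) where

    bound : Bound G
    bound = proj₁ pt

    closed : _≡ₛ_ G (X , Y) (E , F) → P (X , Y) → P (E , F)
    closed = proj₁ (proj₂ pt) _ _

    consistent : Consistent G P
    consistent = proj₁ (proj₂ (proj₂ pt))

    member-orderLt : P (X , Y) → OrderLt G X Y bound
    member-orderLt = proj₂ ∘ proj₁ (proj₂ (proj₂ (proj₂ pt))) _ _

    orients : IsSep G X Y → OrderLt G X Y bound → P (X , Y) ⊎ P (Y , X)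
    orients sep lt = proj₁ (proj₂ (proj₂ (proj₂ (proj₂ pt))) _ _ sep lt)

    both⇒degenerate : P (X , Y) → P (Y , X) → _≡ₛ_ G (X , Y) (Y , X)
    both⇒degenerate p p′ =
      proj₂ (proj₂ (proj₂ (proj₂ (proj₂ pt))) _ _ (proj₁ (proj₁ (proj₂ (proj₂ (proj₂ pt))) _ _ p))
            (member-orderLt p)) p p′

    orients-opposite : P (X , Y) → _≤ₛ_ G (Y , X) (E , F) → ¬ SameSep G (X , Y) (E , F) →
                       IsSep G E F → OrderLt G E F bound → P (F , E)
    orients-opposite p YX≤EF different sep lt with orients sep lt
    ... | inj₂ q = q
    ... | inj₁ q = contradiction YX≤EF (consistent _ _ _ _ p q different)

  module _ {P Q : SepSet G} (ptP : IsPreTangle G P) (ptQ : IsPreTangle G Q) where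
    open PreTangle

    distinguishes⇒nondegenerate : Distinguishes G P Q X Y → ¬ _≡ₛ_ G (X , Y) (Y , X)
    distinguishes⇒nondegenerate (p , q , ¬XY , _) XY≡YX =
      ¬XY ([ id , closed ptP (swap XY≡YX) ]′ p , [ id , closed ptQ (swap XY≡YX) ]′ q)

    opposite⇒distinguishes : ¬ _≡ₛ_ G (X , Y) (Y , X) → P (X , Y) → Q (Y , X) →
                             Distinguishes G P Q X Y
    opposite⇒distinguishes nondeg p q =
        inj₁ p , inj₂ q
      , (λ (_ , q′) → nondeg (both⇒degenerate ptQ q′ q))
      , (λ (p′ , _) → nondeg (both⇒degenerate ptP p p′))

    distinguishes⇒orderLtʳ : Distinguishes G P Q X Y → OrderLt G X Y (bound ptQ)
    distinguishes⇒orderLtʳ (_ , inj₁ q , _) = member-orderLt ptQ q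
    distinguishes⇒orderLtʳ (_ , inj₂ q , _) = orderLt-swap (member-orderLt ptQ q)


module IncreasingChain
    (G : Graph)
    (A B : ℕ → VSet G)
    (sep : ∀ i → IsSep G (A i) (B i))
    (chain : ∀ i → _<ₛ_ G (A i , B i) (A (suc i) , B (suc i)))
    (P : ℕ → SepSet G)
    (pt : ∀ i → IsPreTangle G (P i))
    (im1 : ∀ i → P i (B i , A i) × P (suc i) (A i , B i))
    (eff : ∀ i → EffDistinguishes G (P i) (P (suc i)) (A i) (B i))
    where

  open Separations G
  open PreTangle using (bound; orients; orients-opposite)
  open Equivalence

  S : ℕ → OSep G
  S i = A i , B i

  chain-≤′ : ∀ {a b} → a ≤′ b → _≤ₛ_ G (S a) (S b)
  chain-≤′ ≤′-refl       = (λ _ → id) , (λ _ → id)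
  chain-≤′ {b = suc b} (≤′-step a≤b) = ≤ₛ-trans (chain-≤′ a≤b) (proj₁ (chain b))

  chain-≤ : ∀ {a b} → a ≤ b → _≤ₛ_ G (S a) (S b)
  chain-≤ = chain-≤′ ∘ ≤⇒≤′

  sep-orderLt : ∀ m → OrderLt G (A m) (B m) (bound (pt m))
  sep-orderLt m = orderLt-swap (PreTangle.member-orderLt (pt m) (proj₁ (im1 m)))

  sep-orderLt-suc : ∀ m → OrderLt G (A m) (B m) (bound (pt (suc m)))
  sep-orderLt-suc m = PreTangle.member-orderLt (pt (suc m)) (proj₂ (im1 m))

  sep-order : ∀ m → ∃ (OrderIs G (A m) (B m))
  sep-order m = orderLt⇒orderIs (sep-orderLt m)

  sep-nondegenerate : ∀ m → ¬ _≡ₛ_ G (A m , B m) (B m , A m)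
  sep-nondegenerate m = distinguishes⇒nondegenerate (pt m) (pt (suc m)) (proj₁ (proj₂ (eff m)))

  order-decreases : ∀ {m s s′} → (∀ v → A m v) → OrderIs G (A m) (B m) s →
                    OrderIs G (A (suc m)) (B (suc m)) s′ → s′ < s
  order-decreases {m} total (ys , _ , refl , ys↔) (ys′ , u′ , refl , ys′↔) =
    unique-⊆-⊉⇒length-< u′ ys′⊆ys ys⊈ys′
    where
    A⊆ = proj₁ (proj₁ (chain m))
    B⊇ = proj₂ (proj₁ (chain m))
    ys′⊆ys : ys′ ⊆ ys
    ys′⊆ys {v} v∈ys′ = to (ys↔ v) (total v , B⊇ v (proj₂ (from (ys′↔ v) v∈ys′)))
    ys⊈ys′ : ¬ ys ⊆ ys′
    ys⊈ys′ ys⊆ys′ = proj₂ (chain m)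
      ( (A⊆ , λ v _ → total v)
      , ((λ v Bv → proj₂ (from (ys′↔ v) (ys⊆ys′ (to (ys↔ v) (total v , Bv))))) , B⊇) )

  -- Once A m = V(G), all later A's are V(G), so A ∩ B = B and the strictly shrinking B's
  -- would have strictly decreasing finite orders forever.
  A-not-total : ∀ m → ¬ (∀ v → A m v)
  A-not-total m total = descent∧wf⇒empty descent <-wellFounded _ (m , total , proj₂ (sep-order m))
    where
    TotalOfOrder : ℕ → Set
    TotalOfOrder s = ∃ λ m → (∀ v → A m v) × OrderIs G (A m) (B m) s
    descent : ∀ {s} → TotalOfOrder s → ∃ λ s′ → s′ < s × TotalOfOrder s′
    descent (m , total , o) =
      let s′ , o′ = sep-order (suc m) in
      s′ , order-decreases total o o′ , suc m , (λ v → proj₁ (proj₁ (chain m)) v (total v)) , o′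

  chain-distinct : ∀ {a b} → a < b → ¬ SameSep G (S a) (S b)
  chain-distinct {a} {b} a<b (inj₁ ((_ , Ab⊆Aa) , (Ba⊆Bb , _))) = proj₂ (chain a)
    ( (Aa⊆Aa+1 , λ v → Ab⊆Aa v ∘ proj₁ a+1≤b v)
    , ((λ v → proj₂ a+1≤b v ∘ Ba⊆Bb v) , Ba+1⊆Ba) )
    where
    Aa⊆Aa+1 = proj₁ (proj₁ (chain a))
    Ba+1⊆Ba = proj₂ (proj₁ (chain a))
    a+1≤b = chain-≤ a<b
  chain-distinct {a} {b} a<b (inj₂ ((_ , Bb⊆Aa) , _)) =
    A-not-total b (isSep-total (sep b) λ v → proj₁ (chain-≤ (<⇒≤ a<b)) v ∘ Bb⊆Aa v)

  module _ {i j l : ℕ} (i≤l : i ≤ l) (l<j : l < j)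
           (l-minimal : ∀ m → i ≤ m → m < j → OrderLe (S l) (S m)) where

    private
      n-l = proj₁ (sep-order l)
      o-l = proj₂ (sep-order l)

    orderLt-below : ∀ {m} → i ≤ m → m < j →
                    ∀ {k} → OrderLt G (A m) (B m) k → OrderLt G (A l) (B l) k
    orderLt-below i≤m m<j lt =
      let n , o = orderLt⇒orderIs lt in orderLt-≤ lt o o-l (l-minimal _ i≤m m<j n-l n o-l o)

    earlier-orients-back : ∀ {m} → i ≤ m → m ≤ l → P m (B l , A l)
    earlier-orients-back {m} i≤m m≤l with m≤n⇒m<n∨m≡n m≤l
    ... | inj₂ refl = proj₁ (im1 m)
    ... | inj₁ m<l  = orients-opposite (pt m) (proj₁ (im1 m)) (chain-≤ (<⇒≤ m<l))
        (chain-distinct m<l ∘ sameSep-flipˡ) (sep l)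
        (orderLt-below i≤m (≤-trans m<l (<⇒≤ l<j)) (sep-orderLt m))

    later-orients-forward : ∀ {m} → l < m → m ≤ j → P m (A l , B l)
    later-orients-forward {suc m} (s≤s l≤m) m<j with m≤n⇒m<n∨m≡n l≤m
    ... | inj₂ refl = proj₂ (im1 m)
    ... | inj₁ l<m  = orients-opposite (pt (suc m)) (proj₂ (im1 m)) (swap (chain-≤ (<⇒≤ l<m)))
        (chain-distinct l<m ∘ sameSep-flipˡ ∘ sameSep-sym) (isSep-swap (sep l))
        (orderLt-swap (orderLt-below (≤-trans i≤l l≤m) m<j (sep-orderLt-suc m)))

    distinguishes-i-j : Distinguishes G (P i) (P j) (A l) (B l)
    distinguishes-i-j = Distinguishes-swap {P = P i} {Q = P j}
      (opposite⇒distinguishes (pt i) (pt j) (sep-nondegenerate l ∘ swap)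
        (earlier-orients-back ≤-refl i≤l) (later-orients-forward l<j ≤-refl))

    module _ {X Y : VSet G} {c : ℕ} (sXY : IsSep G X Y) (oXY : OrderIs G X Y c) where

      order-l-≤-step-distinguisher : ∀ {m} → i ≤ m → m < j →
                                     Distinguishes G (P m) (P (suc m)) X Y → n-l ≤ c
      order-l-≤-step-distinguisher {m} i≤m m<j dist =
        let n , o = sep-order m in
        ≤-trans (l-minimal m i≤m m<j n-l n o-l o) (proj₂ (proj₂ (eff m)) X Y sXY dist n c o oXY)

      order-l-≤-unoriented : ∀ {m} → i ≤ m → m < j → ¬ OrderLt G X Y (bound (pt m)) → n-l ≤ c
      order-l-≤-unoriented {m} i≤m m<j ¬lt =
        let n , o = sep-order m in
        ≤-trans (l-minimal m i≤m m<j n-l n o-l o) (¬orderLt⇒≥ (sep-orderLt m) ¬lt o oXY)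

      order-l-≤-distinguisher : Distinguishes G (P i) (P j) X Y → P i (X , Y) → n-l ≤ c
      order-l-≤-distinguisher dXY pi = crossing step pi ¬pj (<⇒≤ (≤-<-trans i≤l l<j))
        where
        ¬pj : ¬ P j (X , Y)
        ¬pj pj = proj₁ (proj₂ (proj₂ dXY)) (pi , pj)
        nondegenerate = distinguishes⇒nondegenerate (pt i) (pt j) dXY
        step : ∀ m → i ≤ m → m < j → P m (X , Y) → P (suc m) (X , Y) ⊎ n-l ≤ c
        step m i≤m m<j pm with orderLt? oXY (bound (pt (suc m)))
        ... | yes lt = [ inj₁ , (λ q → inj₂ (order-l-≤-step-distinguisher i≤m m<j
                          (opposite⇒distinguishes (pt m) (pt (suc m)) nondegenerate pm q))) ]′
                        (orients (pt (suc m)) sXY lt)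
        ... | no ¬lt with m≤n⇒m<n∨m≡n m<j
        ...   | inj₁ m+1<j = inj₂ (order-l-≤-unoriented (≤-trans i≤m (n≤1+n m)) m+1<j ¬lt)
        ...   | inj₂ refl  = contradiction (distinguishes⇒orderLtʳ (pt i) (pt j) dXY) ¬lt

    minimal : ∀ C D → IsSep G C D → Distinguishes G (P i) (P j) C D →
              OrderLe (A l , B l) (C , D)
    minimal C D sCD dCD n c ol oCD = subst (_≤ c) (order-unique o-l ol) (n-l≤c (proj₁ dCD))
      where
      n-l≤c : P i (C , D) ⊎ P i (D , C) → n-l ≤ c
      n-l≤c (inj₁ pi) = order-l-≤-distinguisher sCD oCD dCD pi
      n-l≤c (inj₂ pi) = order-l-≤-distinguisher (isSep-swap sCD) (orderIs-swap oCD)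
                          (Distinguishes-swap {P = P i} {Q = P j} dCD) pi

    efficiently-distinguishes : EffDistinguishes G (P i) (P j) (A l) (B l)
    efficiently-distinguishes = sep l , distinguishes-i-j , minimal

lemma4p3 : (G : Graph)
    → (A B : ℕ → VSet G)
    → (∀ i → IsSep G (A i) (B i))
    → (∀ i → _<ₛ_ G (A i , B i) (A (suc i) , B (suc i)))
    → (P : ℕ → SepSet G)
    → (∀ i → IsPreTangle G (P i))
    → (∀ i → P i (B i , A i) × P (suc i) (A i , B i))
    → (∀ i → EffDistinguishes G (P i) (P (suc i)) (A i) (B i))
    → ∀ i j → i < j
    → ∀ l → i ≤ l → l < j
    → (∀ l' → i ≤ l' → l' < j → ∀ n m → OrderIs G (A l) (B l) n → OrderIs G (A l') (B l') m → n ≤ m)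
    → EffDistinguishes G (P i) (P j) (A l) (B l)
-- i < j is implied by i ≤ l < j.
lemma4p3 G A B sep chain P pt im1 eff i j _ l i≤l l<j l-minimal =
  IncreasingChain.efficiently-distinguishes G A B sep chain P pt im1 eff i≤l l<j l-minimal
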